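{- Let $H$ be a finite graph and $r,s\ge 1$ integers. Every cautious $(r,s)$-protocol for $H$ is monotone.
   Context: Discrete-time immunization model. Fix integers $r,s\ge 1$ and a finite graph $H$. An $(r,s)$-protocol for $H$ is a finite sequence $(A_1,\dots,A_N)$ of subsets of $V(H)$ ($A_t$ is the set of vertices immunized at time-step $t$). At time-step $0$ every vertex is red. For each $t\ge 1$ every vertex lies in exactly one of $G_t^r,\dots,G_t^1$ (green), $Y_t^s,\dots,Y_t^1$ (yellow), $R_t$ (red), determined as follows: if $v\in A_t$ then $v\in G_t^r$. If $v\notin A_t$: if $v$ was red at time $t-1$ or $v\in Y_{t-1}^1$, then $v\in R_t$; if $v\in Y_{t-1}^i$ with $2\le i\le s$, then $v\in Y_t^{i-1}$; if $v\in G_{t-1}^i$ with $2\le i\le r$, then $v\in G_t^{i-1}$; if $v\in G_{t-1}^1$ and $v$ has a neighbor in $R_t$, then $v\in Y_t^s$; otherwise $v\in G_t^1$. The protocol clears $H$ if all vertices are green at time-step $N$. An $(r,s)$-protocol that clears $H$ is monotone if for every $v\in V(H)$: whenever $v\in A_j$, $v\notin R_i$ for all $i>j$. An $(r,s)$-protocol that clears $H$ is cautious if for every vertex $w$: if the first immunization set containing $w$ is $A_j$ and the last is $A_k$, then among any $r+s$ consecutive members of the sequence $A_j,A_{j+1},\dots,A_k$, at least one contains $w$. -}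

module Defs where

open import Data.Nat using (ℕ; zero; suc; _+_; _≤_; _<_)
open import Data.Fin using (Fin)
open import Data.Fin.Subset using (Subset; _∈_; _∉_; Side; inside; outside)
open import Data.Vec using (lookup)
open import Data.Bool using (Bool; true; false; if_then_else_; _∧_; not)
open import Data.List using (allFin)
open import Data.Bool.ListAction using (any)
open import Data.Product using (∃; _×_)
open import Relation.Binary.PropositionalEquality using (_≡_; _≢_)

record Graph (n : ℕ) : Set where
  field
    adj   : Fin n → Fin n → Bool
    sym   : ∀ u v → adj u v ≡ adj v u
    irrefl : ∀ v → adj v v ≡ false

-- Vertex states: green i = G^i (1 ≤ i ≤ r), yellow i = Y^i (1 ≤ i ≤ s), red = R.
data State : Set where
  green  : ℕ → State
  yellow : ℕ → State
  red    : State

IsGreen : State → Set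
IsGreen (green _) = Data.Unit.⊤ where import Data.Unit
IsGreen (yellow _) = Data.Empty.⊥ where import Data.Empty
IsGreen red = Data.Empty.⊥ where import Data.Empty

inSet : ∀ {n} → Subset n → Fin n → Bool
inSet A v with lookup A v
... | inside  = true
... | outside = false

-- v ∈ R_t, given the state σ at time t-1 and immunization set A = A_t
becomesRed : ∀ {n} → (Fin n → State) → Subset n → Fin n → Bool
becomesRed σ A v with inSet A v | σ v
... | true  | _ = false
... | false | red = true
... | false | yellow 1 = true
... | false | _ = false

step : ∀ {n} → Graph n → (r s : ℕ) → (Fin n → State) → Subset n → Fin n → State
step {n} H r s σ A v with inSet A v | σ v
... | true  | _ = green r
... | false | red = red
... | false | yellow 1 = red
... | false | yellow (suc (suc k)) = yellow (suc k)
... | false | green (suc (suc k)) = green (suc k)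
... | false | green 1 =
  if any (λ u → Graph.adj H v u ∧ becomesRed σ A u) (allFin n)
  then yellow s else green 1
-- unreachable states (index 0) for r, s ≥ 1; kept fixed
... | false | yellow 0 = yellow 0
... | false | green 0 = green 0

-- A protocol (A_1, …, A_N) is given by N and A : ℕ → Subset n, of which only
-- A 1, …, A N are used.  state H r s A t v is the state of v at time-step t.
state : ∀ {n} → Graph n → (r s : ℕ) → (ℕ → Subset n) → ℕ → Fin n → State
state H r s A zero v = red
state H r s A (suc t) = step H r s (state H r s A t) (A (suc t))

Clears : ∀ {n} → Graph n → (r s : ℕ) → (N : ℕ) → (ℕ → Subset n) → Set
Clears H r s N A = ∀ v → IsGreen (state H r s A N v)

Monotone : ∀ {n} → Graph n → (r s : ℕ) → (N : ℕ) → (ℕ → Subset n) → Set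
Monotone H r s N A =
  Clears H r s N A ×
  (∀ v j → 1 ≤ j → j ≤ N → v ∈ A j → ∀ i → j < i → i ≤ N → state H r s A i v ≢ red)

IsFirst : ∀ {n} → (N : ℕ) → (ℕ → Subset n) → Fin n → ℕ → Set
IsFirst N A w j = 1 ≤ j × j ≤ N × w ∈ A j × (∀ i → 1 ≤ i → i < j → w ∉ A i)

IsLast : ∀ {n} → (N : ℕ) → (ℕ → Subset n) → Fin n → ℕ → Set
IsLast N A w k = 1 ≤ k × k ≤ N × w ∈ A k × (∀ i → k < i → i ≤ N → w ∉ A i)

Cautious : ∀ {n} → Graph n → (r s : ℕ) → (N : ℕ) → (ℕ → Subset n) → Set
Cautious H r s N A =
  Clears H r s N A ×
  (∀ w j k → IsFirst N A w j → IsLast N A w k →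
     ∀ m → j ≤ m → m + (r + s) ≤ suc k →
       ∃ λ l → m ≤ l × l < m + (r + s) × w ∈ A l)

{-# OPTIONS --safe #-}
-- A vertex's distance from turning red is measured by potential s of its state:
-- immunization sets it to r + s, and a step without immunization lowers it by at
-- most one, so a vertex is never red within r + s steps of an immunization.  In a
-- cautious protocol every time between a vertex's first and last immunization lies
-- within r + s steps after some immunization; after its last immunization a red
-- vertex would stay red up to time N, contradicting that the protocol clears H.
module Submission where

open import Defs
open import Data.Nat using (ℕ; _≤_)
open import Data.Fin.Subset using (Subset)

open import Data.Nat using (zero; suc; _+_; _∸_; _<_; _≤′_; ≤′-refl; ≤′-step; s≤s; z≤n; _≤?_; _<?_; s≤s⁻¹)
open import Data.Nat.Properties
open import Data.Nat.Induction using (<-rec)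
open import Data.Fin using (Fin)
open import Data.Fin.Subset using (_∈_; _∉_; inside; outside)
open import Data.Fin.Subset.Properties using (_∈?_)
open import Data.Vec using (lookup)
open import Data.Vec.Properties using ([]=⇒lookup; lookup⇒[]=)
open import Data.Bool using (true; false; if_then_else_; _∧_)
open import Data.Bool.ListAction using (any)
open import Data.List using (allFin)
open import Data.Product using (∃; _×_; _,_)
open import Data.Sum using (inj₁; inj₂)
open import Data.Empty using (⊥-elim)
open import Relation.Nullary using (¬_; yes; no; contradiction)
open import Relation.Nullary.Decidable using (_×-dec_)
open import Relation.Unary using (Decidable)
open import Relation.Binary.PropositionalEquality using (_≡_; _≢_; refl; sym; cong; subst)

module _ {P : ℕ → Set} (P? : Decidable P) where

  least-witness : ∀ j → P j → ∃ λ i → i ≤ j × P i × (∀ l → l < i → ¬ P l)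
  least-witness = <-rec Goal search
    where
    Goal : ℕ → Set
    Goal j = P j → ∃ λ i → i ≤ j × P i × (∀ l → l < i → ¬ P l)

    search : ∀ j → (∀ {i} → i < j → Goal i) → Goal j
    search j rec Pj with anyUpTo? P? j
    ... | no none-below = j , ≤-refl , Pj , λ l l<j Pl → none-below (l , l<j , Pl)
    ... | yes (i , i<j , Pi) with rec i<j Pi
    ...   | l , l≤i , Pl , minimal = l , ≤-trans l≤i (<⇒≤ i<j) , Pl , minimal

  greatest-witness : ∀ N {j} → j ≤ N → P j →
    ∃ λ k → j ≤ k × k ≤ N × P k × (∀ l → k < l → l ≤ N → ¬ P l)
  greatest-witness N j≤N Pj with P? N
  ... | yes PN = N , j≤N , ≤-refl , PN , λ l N<l l≤N → contradiction l≤N (<⇒≱ N<l)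
  greatest-witness zero z≤n Pj | no ¬P0 = contradiction Pj ¬P0
  greatest-witness (suc N) j≤1+N Pj | no ¬P1+N with m≤n⇒m<n∨m≡n j≤1+N
  ... | inj₂ refl = contradiction Pj ¬P1+N
  ... | inj₁ j<1+N with greatest-witness N (s≤s⁻¹ j<1+N) Pj
  ...   | k , j≤k , k≤N , Pk , maximal = k , j≤k , m≤n⇒m≤1+n k≤N , Pk , maximal′
    where
    maximal′ : ∀ l → k < l → l ≤ suc N → ¬ P l
    maximal′ l k<l l≤1+N with m≤n⇒m<n∨m≡n l≤1+N
    ... | inj₁ l<1+N = maximal l k<l (s≤s⁻¹ l<1+N)
    ... | inj₂ refl  = ¬P1+N

∈⇒inSet≡true : ∀ {n} {A : Subset n} {v} → v ∈ A → inSet A v ≡ true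
∈⇒inSet≡true v∈A rewrite []=⇒lookup v∈A = refl

∉⇒inSet≡false : ∀ {n} {A : Subset n} {v} → v ∉ A → inSet A v ≡ false
∉⇒inSet≡false {A = A} {v} v∉A with lookup A v in eq
... | inside  = ⊥-elim (v∉A (lookup⇒[]= v A eq))
... | outside = refl

potential : ℕ → State → ℕ
potential s (green i)  = i + s
potential s (yellow i) = i
potential s red        = 0

module _ {n} (H : Graph n) (r s : ℕ) where

  step-immunized : ∀ σ {A : Subset n} {v} → v ∈ A → step H r s σ A v ≡ green r
  step-immunized σ v∈A rewrite ∈⇒inSet≡true v∈A = refl

  step-red : ∀ σ {A : Subset n} {v} → v ∉ A → σ v ≡ red → step H r s σ A v ≡ red
  step-red σ v∉A σv≡red rewrite ∉⇒inSet≡false v∉A | σv≡red = refl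

  potential-leaving-green-1 : ∀ b → s ≤ potential s (if b then yellow s else green 1)
  potential-leaving-green-1 true  = ≤-refl
  potential-leaving-green-1 false = n≤1+n s

  potential-step : ∀ σ {A : Subset n} {v} → v ∉ A →
    potential s (σ v) ≤ suc (potential s (step H r s σ A v))
  potential-step σ {A} {v} v∉A rewrite ∉⇒inSet≡false v∉A with σ v
  ... | red                 = z≤n
  ... | yellow zero         = z≤n
  ... | yellow (suc zero)   = ≤-refl
  ... | yellow (suc (suc k)) = ≤-refl
  ... | green zero          = n≤1+n s
  ... | green (suc zero)    =
    s≤s (potential-leaving-green-1 (any (λ u → Graph.adj H v u ∧ becomesRed σ A u) (allFin n)))
  ... | green (suc (suc k)) = ≤-refl

module _ {n} (H : Graph n) (r s : ℕ) (A : ℕ → Subset n) where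

  potential-after-immunization : ∀ {v t i} → v ∈ A (suc t) → suc t ≤′ i →
    suc t + (r + s) ≤ i + potential s (state H r s A i v)
  potential-after-immunization {v} {t} v∈A ≤′-refl
    rewrite step-immunized H r s (state H r s A t) v∈A = ≤-refl
  potential-after-immunization {v} {t} v∈A (≤′-step {i} t<i) with v ∈? A (suc i)
  ... | yes v∈Ai rewrite step-immunized H r s (state H r s A i) v∈Ai =
    +-monoˡ-≤ (r + s) (≤′⇒≤ (≤′-step t<i))
  ... | no v∉Ai = begin
    suc t + (r + s)                                ≤⟨ potential-after-immunization v∈A t<i ⟩
    i + potential s (state H r s A i v)            ≤⟨ +-monoʳ-≤ i (potential-step H r s _ v∉Ai) ⟩
    i + suc (potential s (state H r s A (suc i) v)) ≡⟨ +-suc i _ ⟩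
    suc i + potential s (state H r s A (suc i) v)  ∎
    where open ≤-Reasoning

  not-red-within-window : ∀ {v t i} → 1 ≤ t → v ∈ A t → t ≤ i → i < t + (r + s) →
    state H r s A i v ≢ red
  not-red-within-window {v} {suc t} {i} _ v∈At t≤i i<t+r+s red-at-i = <⇒≱ i<t+r+s (begin
    suc t + (r + s)                     ≤⟨ potential-after-immunization v∈At (≤⇒≤′ t≤i) ⟩
    i + potential s (state H r s A i v) ≡⟨ cong (λ σ → i + potential s σ) red-at-i ⟩
    i + 0                               ≡⟨ +-identityʳ i ⟩
    i                                   ∎)
    where open ≤-Reasoning

  red-persists : ∀ {v i N} → (∀ l → i < l → l ≤ N → v ∉ A l) → i ≤′ N →
    state H r s A i v ≡ red → state H r s A N v ≡ red
  red-persists never ≤′-refl red-at-i = red-at-i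
  red-persists never (≤′-step {N} i≤N) red-at-i =
    step-red H r s _ (never (suc N) (s≤s (≤′⇒≤ i≤N)) ≤-refl)
      (red-persists (λ l i<l l≤N → never l i<l (m≤n⇒m≤1+n l≤N)) i≤N red-at-i)

module _ {n N} (A : ℕ → Subset n) {v : Fin n} {j}
         (1≤j : 1 ≤ j) (j≤N : j ≤ N) (v∈Aj : v ∈ A j) where

  first-immunization : ∃ λ j₀ → j₀ ≤ j × IsFirst N A v j₀
  first-immunization with least-witness (λ i → 1 ≤? i ×-dec v ∈? A i) j (1≤j , v∈Aj)
  ... | j₀ , j₀≤j , (1≤j₀ , v∈Aj₀) , minimal =
    j₀ , j₀≤j , 1≤j₀ , ≤-trans j₀≤j j≤N , v∈Aj₀ , λ i 1≤i i<j₀ v∈Ai → minimal i i<j₀ (1≤i , v∈Ai)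

  last-immunization : ∃ (IsLast N A v)
  last-immunization with greatest-witness (λ i → v ∈? A i) N j≤N v∈Aj
  ... | k , j≤k , k≤N , v∈Ak , maximal = k , ≤-trans 1≤j j≤k , k≤N , v∈Ak , maximal

window-ending-at : ∀ {j i} w → j + w ≤ suc i → ∃ λ m → j ≤ m × m + w ≡ suc i
window-ending-at {j} {i} w j+w≤1+i =
  suc i ∸ w , m+n≤o⇒m≤o∸n j j+w≤1+i , m∸n+n≡m (≤-trans (m≤n+m w j) j+w≤1+i)

immunized-within-window : ∀ {n} {H : Graph n} {r s N} {A : ℕ → Subset n} {v j k i} →
  Cautious H r s N A → IsFirst N A v j → IsLast N A v k → j ≤ i → i ≤ k →
  ∃ λ l → 1 ≤ l × v ∈ A l × l ≤ i × i < l + (r + s)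
immunized-within-window {r = r} {s} {v = v} {j} {k} {i}
  (_ , cautious) first@(1≤j , _ , v∈Aj , _) last j≤i i≤k with i <? j + (r + s)
... | yes i<j+r+s = j , 1≤j , v∈Aj , j≤i , i<j+r+s
... | no i≮j+r+s with window-ending-at (r + s) (m≤n⇒m≤1+n (≮⇒≥ i≮j+r+s))
...   | m , j≤m , m+r+s≡1+i
  with cautious v j k first last m j≤m (subst (_≤ suc k) (sym m+r+s≡1+i) (s≤s i≤k))
...   | l , m≤l , l<m+r+s , v∈Al = l , ≤-trans 1≤j (≤-trans j≤m m≤l) , v∈Al , l≤i , i<l+r+s
  where
  l≤i : l ≤ i
  l≤i = s≤s⁻¹ (subst (l <_) m+r+s≡1+i l<m+r+s)

  i<l+r+s : i < l + (r + s)
  i<l+r+s = subst (_≤ l + (r + s)) m+r+s≡1+i (+-monoˡ-≤ (r + s) m≤l)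

theorem3p8 : ∀ {n} (H : Graph n) (r s : ℕ) → 1 ≤ r → 1 ≤ s →
    (N : ℕ) (A : ℕ → Subset n) → Cautious H r s N A → Monotone H r s N A
theorem3p8 H r s _ _ N A cautious@(clears , _) = clears , never-red-again
  where
  never-red-again : ∀ v j → 1 ≤ j → j ≤ N → v ∈ A j → ∀ i → j < i → i ≤ N →
    state H r s A i v ≢ red
  never-red-again v j 1≤j j≤N v∈Aj i j<i i≤N red-at-i
    with first-immunization A 1≤j j≤N v∈Aj | last-immunization A 1≤j j≤N v∈Aj
  ... | j₀ , j₀≤j , first | k , last@(_ , _ , _ , none-after-k) with i ≤? k
  ... | no i≰k = subst IsGreen red-at-N (clears v)
    where
    red-at-N : state H r s A N v ≡ red
    red-at-N = red-persists H r s A (λ l i<l → none-after-k l (<-trans (≰⇒> i≰k) i<l))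
                 (≤⇒≤′ i≤N) red-at-i
  ... | yes i≤k with immunized-within-window cautious first last (≤-trans j₀≤j (<⇒≤ j<i)) i≤k
  ...   | l , 1≤l , v∈Al , l≤i , i<l+r+s =
    not-red-within-window H r s A 1≤l v∈Al l≤i i<l+r+s red-at-i
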